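{- Let $n\geqslant 1$ be a natural number and $\beta_n=\Diamond\Box\perp\wedge\Diamond^n\Diamond\Box\perp\wedge\bigwedge_{k=2}^{n-1}\neg\Diamond^k\Diamond\Box\perp$. Then $\neg\beta_n\in L_1$ if, and only if, $n$ is odd.
   Context: Predicate modal formulas use countably many predicate letters of each arity, $\neg,\wedge,\Box,\forall$, with $\Diamond=\neg\Box\neg$, $\perp$ a contradiction, $\Diamond^0\psi=\psi$, $\Diamond^{m+1}\psi=\Diamond\Diamond^m\psi$; an empty conjunction is true. A frame is $\langle W,R\rangle$, $W\neq\emptyset$; predicate frames assign nonempty expanding domains; models interpret letters at each world; $\Box$ quantifies over $R$-successors. A formula is valid on a frame if true at all worlds under all assignments in all models over all predicate frames over it. For $n\geqslant 2$, $\mathfrak{G}_n=\langle W_n,R_n\rangle$ with $W_n=\{w_1,\dots,w_n,w^\ast\}$, $R_n=\{\langle w_i,w_{i+1}\rangle:1\leqslant i<n\}\cup\{\langle w_n,w_1\rangle,\langle w_1,w^\ast\rangle\}$. $L_1$ is the set of formulas valid on every $\mathfrak{G}_n$ with $n\geqslant 2$ even. -}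

module Defs where

open import Data.Nat using (ℕ; zero; suc; _+_; _*_; _∸_; _≟_)
open import Data.Fin using (Fin; toℕ)
open import Data.Vec using (Vec; []; _∷_; map)
open import Data.List using (List; []; _∷_; applyUpTo)
open import Data.Product using (Σ; ∃; _×_; _,_)
open import Data.Sum using (_⊎_; inj₁; inj₂)
open import Data.Unit using (⊤; tt)
open import Data.Empty using (⊥)
open import Relation.Nullary using (¬_; yes; no)
open import Relation.Binary.PropositionalEquality using (_≡_)

-- Syntax of predicate modal formulas.
-- Individual variables are natural numbers; predicate letters are
-- indexed by (arity k, number P), so there are countably many of each arity.

Var : Set
Var = ℕ

data Formula : Set where
  atom : (k : ℕ) → (P : ℕ) → Vec Var k → Formula
  ~_   : Formula → Formula
  _∧_  : Formula → Formula → Formula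
  □_   : Formula → Formula
  ∀′   : Var → Formula → Formula

infixr 6 _∧_
infix  7 ~_ □_ ◇_

◇_ : Formula → Formula
◇ φ = ~ □ ~ φ

⊥f : Formula
⊥f = atom 0 0 [] ∧ ~ atom 0 0 []

◇^ : ℕ → Formula → Formula
◇^ zero    ψ = ψ
◇^ (suc m) ψ = ◇ (◇^ m ψ)

⋀ : List Formula → Formula
⋀ []       = ~ ⊥f
⋀ (φ ∷ φs) = φ ∧ ⋀ φs

β : ℕ → Formula
β n = ◇ □ ⊥f ∧ ◇^ n (◇ □ ⊥f)
        ∧ ⋀ (applyUpTo (λ i → ~ ◇^ (2 + i) (◇ □ ⊥f)) (n ∸ 2))

record Frame : Set₁ where
  field
    W : Set
    R : W → W → Set
    inhabited : W

record PredFrame (F : Frame) : Set₁ where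
  open Frame F
  field
    U         : Set
    D         : W → U → Set
    nonempty  : (w : W) → Σ U (D w)
    expanding : ∀ {w v} → R w v → ∀ {a} → D w a → D v a

record Model (F : Frame) : Set₁ where
  field
    pf : PredFrame F
  open PredFrame pf public
  field
    I : Frame.W F → (k : ℕ) → (P : ℕ) → Vec U k → Set

module _ {F : Frame} (M : Model F) where
  open Frame F
  open Model M

  Assignment : Set
  Assignment = Var → U

  _[_↦_] : Assignment → Var → U → Assignment
  (g [ x ↦ a ]) y with y ≟ x
  ... | yes _ = a
  ... | no  _ = g y

  _,_⊨_ : W → Assignment → Formula → Set
  w , g ⊨ atom k P xs = I w k P (map g xs)
  w , g ⊨ (~ φ)       = ¬ (w , g ⊨ φ)
  w , g ⊨ (φ ∧ ψ)     = (w , g ⊨ φ) × (w , g ⊨ ψ)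
  w , g ⊨ (□ φ)       = ∀ v → R w v → v , g ⊨ φ
  w , g ⊨ ∀′ x φ      = ∀ a → D w a → w , (g [ x ↦ a ]) ⊨ φ

ValidOn : Frame → Formula → Set₁
ValidOn F φ = (M : Model F) (w : Frame.W F) (g : Var → Model.U M) →
              (∀ x → Model.D M w (g x)) → _,_⊨_ M w g φ

-- The frames 𝔊_m.  Worlds: inj₁ i is w_{i+1} (i : Fin m), inj₂ tt is w*.

data Rel (m : ℕ) : Fin m ⊎ ⊤ → Fin m ⊎ ⊤ → Set where
  step : (i j : Fin m) → toℕ j ≡ suc (toℕ i) → Rel m (inj₁ i) (inj₁ j)
  wrap : (i j : Fin m) → suc (toℕ i) ≡ m → toℕ j ≡ 0 → Rel m (inj₁ i) (inj₁ j)
  star : (i : Fin m) → toℕ i ≡ 0 → Rel m (inj₁ i) (inj₂ tt)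

𝔊 : ℕ → Frame
𝔊 m = record { W = Fin m ⊎ ⊤ ; R = Rel m ; inhabited = inj₂ tt }

Even Odd : ℕ → Set
Even m = ∃ λ k → m ≡ 2 * k
Odd  m = ∃ λ k → m ≡ suc (2 * k)

_∈L₁ : Formula → Set₁
φ ∈L₁ = ∀ m → 2 Data.Nat.≤ m → Even m → ValidOn (𝔊 m) φ

module Submission where

-- In the frame 𝔊 m the formula δ = ◇□⊥ ("some successor is a
-- dead end") holds exactly at w₁, the only world that sees w*.  Because the
-- worlds w₁ … w_m form a directed cycle of length m (w* being a sink that
-- refutes every ◇-formula), the central lemma reads
--
--     w_{i+1} ⊨ ◇^k δ   iff   m ∣ i + k          (◇^k-δ-iff)
--
-- in every model on 𝔊 m.  The theorem is a short consequence of this: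
--   * n odd:  β n at a world w forces w = w₁ and m ∣ n; with m even this
--     makes n even, which is impossible, so ¬β n is valid on every 𝔊 m;
--   * n even: on 𝔊 n the world w₁ satisfies β n, since n ∣ 0 + n while
--     n ∤ k for 2 ≤ k < n; hence ¬β n ∉ L₁.

open import Defs
open import Data.Nat using (ℕ; _≤_)
open import Function.Bundles using (_⇔_)

open import Data.Nat using (zero; suc; _+_; _<_; s≤s; z≤n; _≟_; _<?_)
open import Data.Nat.Properties using (+-suc; +-identityʳ; *-comm; *-suc; ≤-antisym; ≮⇒≥; <-irrefl; m≤m*n; even≢odd)
open import Data.Nat.Divisibility using (_∣_; divides; _∣?_; ∣-refl; ∣-trans; _∣0; ∣m+n∣m⇒∣n; ∣m∣n⇒∣m+n; >⇒∤)
open import Data.Fin using (Fin; toℕ; fromℕ<) renaming (zero to fzero)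
open import Data.Fin.Properties using (toℕ-fromℕ<; toℕ<n)
open import Data.Product using (Σ; _,_; proj₂)
open import Data.Sum using (_⊎_; inj₁; inj₂)
open import Data.Unit using (⊤; tt)
open import Data.Empty using (⊥; ⊥-elim)
open import Data.List using (applyUpTo)
open import Relation.Nullary using (¬_; yes; no)
open import Relation.Nullary.Decidable using (decidable-stable)
open import Relation.Binary.PropositionalEquality using (_≡_; _≢_; refl; sym; trans; cong; subst)
open import Function.Bundles using (mk⇔; Equivalence)
open Equivalence using (to; from)

module Modal {F : Frame} (M : Model F) (g : Var → Model.U M) where
  open Frame F

  infix 4 _⊩_
  _⊩_ : W → Formula → Set
  w ⊩ φ = _,_⊨_ M w g φ

  ◇-intro : ∀ {w v φ} → R w v → v ⊩ φ → w ⊩ ◇ φ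
  ◇-intro w→v v⊩φ no-witness = no-witness _ w→v v⊩φ

  successor⇒¬□⊥ : ∀ {w v} → R w v → ¬ w ⊩ □ ⊥f
  successor⇒¬□⊥ w→v w⊩□⊥ with w⊩□⊥ _ w→v
  ... | p , ¬p = ¬p p

  ⋀-intro : ∀ w len (f : ℕ → Formula) →
            (∀ i → i < len → w ⊩ f i) → w ⊩ ⋀ (applyUpTo f len)
  ⋀-intro w zero      f all = λ { (p , ¬p) → ¬p p }
  ⋀-intro w (suc len) f all =
    all zero (s≤s z≤n) , ⋀-intro w len (λ i → f (suc i)) (λ i i<len → all (suc i) (s≤s i<len))

cycle-successor : ∀ {m} (i : Fin m) → Σ (Fin m) λ j → Rel m (inj₁ i) (inj₁ j)
cycle-successor {suc m} i with suc (toℕ i) <? suc m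
... | yes i+1<m = fromℕ< i+1<m , step i _ (toℕ-fromℕ< i+1<m)
... | no  i+1≮m = fzero , wrap i fzero (≤-antisym (toℕ<n i) (≮⇒≥ i+1≮m)) refl

-- Along a cycle edge w_{i+1} → w_{j+1}, the condition "i + (k+1) ≡ 0 mod m"
-- becomes "j + k ≡ 0 mod m": indices advance by one, or wrap around from m to 0.
cycle-shift : ∀ {m i j} k → Rel m (inj₁ i) (inj₁ j) → m ∣ toℕ i + suc k ⇔ m ∣ toℕ j + k
cycle-shift {m} {i} k (step _ j j≡i+1) = mk⇔ (subst (m ∣_) (sym same)) (subst (m ∣_) same)
  where
  same : toℕ j + k ≡ toℕ i + suc k
  same = trans (cong (_+ k) j≡i+1) (sym (+-suc (toℕ i) k))
cycle-shift {m} {i} k (wrap _ j i+1≡m j≡0) = mk⇔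
  (λ m∣ → subst (m ∣_) (sym j+k≡k) (∣m+n∣m⇒∣n (subst (m ∣_) i+k+1≡m+k m∣) ∣-refl))
  (λ m∣ → subst (m ∣_) (sym i+k+1≡m+k) (∣m∣n⇒∣m+n ∣-refl (subst (m ∣_) j+k≡k m∣)))
  where
  i+k+1≡m+k : toℕ i + suc k ≡ m + k
  i+k+1≡m+k = trans (+-suc (toℕ i) k) (cong (_+ k) i+1≡m)
  j+k≡k : toℕ j + k ≡ k
  j+k≡k = cong (_+ k) j≡0

∣-below⇒≡0 : ∀ {m a} → a < m → m ∣ a → a ≡ 0
∣-below⇒≡0 {a = zero}  _   _   = refl
∣-below⇒≡0 {a = suc _} a<m m∣a = ⊥-elim (>⇒∤ a<m m∣a)

module Cycle {m : ℕ} (M : Model (𝔊 m)) (g : Var → Model.U M) where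
  open Modal M g

  δ : Formula
  δ = ◇ □ ⊥f

  -- w* has no successors, so it refutes every formula of the form ◇^k ◇ψ.
  w*-refutes : ∀ k {ψ} → ¬ inj₂ tt ⊩ ◇^ k (◇ ψ)
  w*-refutes zero    no-witness = no-witness (λ _ ())
  w*-refutes (suc k) no-witness = no-witness (λ _ ())

  -- δ holds at w_{i+1} exactly when i = 0: w* is the only dead end of 𝔊 m.
  -- (◇ is ¬□¬, so extracting i = 0 uses decidability of equality on ℕ.)
  δ-iff : ∀ i → inj₁ i ⊩ δ ⇔ toℕ i ≡ 0
  δ-iff i = mk⇔ (λ i⊩δ → decidable-stable (toℕ i ≟ 0) (λ i≢0 → i⊩δ (no-dead-successor i≢0)))
                (λ i≡0 → ◇-intro {φ = □ ⊥f} (star i i≡0) (λ _ ()))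
    where
    no-dead-successor : toℕ i ≢ 0 → ∀ v → Rel m (inj₁ i) v → ¬ v ⊩ □ ⊥f
    no-dead-successor _   _ (step _ j _)   = successor⇒¬□⊥ (proj₂ (cycle-successor j))
    no-dead-successor _   _ (wrap _ j _ _) = successor⇒¬□⊥ (proj₂ (cycle-successor j))
    no-dead-successor i≢0 _ (star _ i≡0)   = ⊥-elim (i≢0 i≡0)

  ◇^k-δ-iff : ∀ k i → inj₁ i ⊩ ◇^ k δ ⇔ m ∣ toℕ i + k
  ◇^k-δ-iff zero i = mk⇔
    (λ i⊩δ → subst (m ∣_) (sym (cong (_+ 0) (to (δ-iff i) i⊩δ))) (m ∣0))
    (λ m∣i+0 → from (δ-iff i) (∣-below⇒≡0 (toℕ<n i) (subst (m ∣_) (+-identityʳ (toℕ i)) m∣i+0)))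
  ◇^k-δ-iff (suc k) i = mk⇔ sound complete
    where
    refute : ¬ m ∣ toℕ i + suc k → ∀ v → Rel m (inj₁ i) v → ¬ v ⊩ ◇^ k δ
    refute m∤ (inj₁ j) i→j j⊩ = m∤ (from (cycle-shift k i→j) (to (◇^k-δ-iff k j) j⊩))
    refute m∤ (inj₂ tt) _      = w*-refutes k

    -- ◇ only gives a double negation; decidability of ∣ removes it.
    sound : inj₁ i ⊩ ◇^ (suc k) δ → m ∣ toℕ i + suc k
    sound i⊩ = decidable-stable (m ∣? _) (λ m∤ → i⊩ (refute m∤))

    complete : m ∣ toℕ i + suc k → inj₁ i ⊩ ◇^ (suc k) δ
    complete m∣ with cycle-successor i
    ... | j , i→j = ◇-intro {φ = ◇^ k δ} i→j (from (◇^k-δ-iff k j) (to (cycle-shift k i→j) m∣))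

even-or-odd : ∀ n → Even n ⊎ Odd n
even-or-odd zero = inj₁ (0 , refl)
even-or-odd (suc n) with even-or-odd n
... | inj₁ (c , n≡2c)   = inj₂ (c , cong suc n≡2c)
... | inj₂ (c , n≡2c+1) = inj₁ (suc c , trans (cong suc n≡2c+1) (sym (*-suc 2 c)))

even⇒2∣ : ∀ {n} → Even n → 2 ∣ n
even⇒2∣ (c , n≡2c) = divides c (trans n≡2c (*-comm 2 c))

odd⇒2∤ : ∀ {n} → Odd n → ¬ 2 ∣ n
odd⇒2∤ (c , refl) (divides q 2c+1≡q2) = even≢odd q c (trans (*-comm 2 q) (sym 2c+1≡q2))

even⇒≥2 : ∀ {n} → 1 ≤ n → Even n → 2 ≤ n
even⇒≥2 1≤n (zero  , refl)  = ⊥-elim (<-irrefl refl 1≤n)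
even⇒≥2 _   (suc c , n≡2c)  = subst (2 ≤_) (sym n≡2c) (m≤m*n 2 (suc c))

-- The model with one individual and all predicates false; any model would do.
trivial-model : (m : ℕ) → Model (𝔊 m)
trivial-model m = record
  { pf = record { U = ⊤ ; D = λ _ _ → ⊤ ; nonempty = λ _ → tt , tt ; expanding = λ _ _ → tt }
  ; I  = λ _ _ _ _ → ⊥ }

-- For odd n, β n is refuted everywhere on every 𝔊 m with m even:
-- it would force the world to be w₁ and m ∣ n, making n even.
odd⇒valid : ∀ {n} → Odd n → (~ β n) ∈L₁
odd⇒valid {n} odd m _ even M (inj₂ tt) g _ (w*⊩δ , _) = Cycle.w*-refutes M g 0 {□ ⊥f} w*⊩δ
odd⇒valid {n} odd m _ even M (inj₁ i) g _ (i⊩δ , i⊩◇ⁿδ , _) =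
  odd⇒2∤ odd (∣-trans (even⇒2∣ even) m∣n)
  where
  open Cycle M g
  m∣n : m ∣ n
  m∣n = subst (λ a → m ∣ a + n) (to (δ-iff i) i⊩δ) (to (◇^k-δ-iff n i) i⊩◇ⁿδ)

-- For even n ≥ 2, β n holds at w₁ of 𝔊 n: it returns to w₁ after exactly n
-- steps and not after k steps for 2 ≤ k < n.
even⇒invalid : ∀ {n} → 2 ≤ n → Even n → ¬ (~ β n) ∈L₁
even⇒invalid {n@(suc (suc p))} 2≤n@(s≤s (s≤s _)) even valid =
  valid n 2≤n even M (inj₁ fzero) g (λ _ → tt) w₁⊩β
  where
  M = trivial-model n
  g : Var → ⊤
  g _ = tt
  open Modal M g
  open Cycle M g

  no-early-return : ∀ i → i < p → ¬ inj₁ fzero ⊩ ◇^ (2 + i) δ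
  no-early-return i i<p w₁⊩ = >⇒∤ (s≤s (s≤s i<p)) (to (◇^k-δ-iff (2 + i) fzero) w₁⊩)

  w₁⊩β : inj₁ fzero ⊩ β n
  w₁⊩β = from (δ-iff fzero) refl
       , from (◇^k-δ-iff n fzero) ∣-refl
       , ⋀-intro (inj₁ fzero) p (λ i → ~ ◇^ (2 + i) δ) no-early-return

lemma9 : (n : ℕ) → 1 ≤ n → ((~ β n) ∈L₁) ⇔ Odd n
lemma9 n 1≤n = mk⇔ valid⇒odd odd⇒valid
  where
  valid⇒odd : (~ β n) ∈L₁ → Odd n
  valid⇒odd valid with even-or-odd n
  ... | inj₂ odd  = odd
  ... | inj₁ even = ⊥-elim (even⇒invalid (even⇒≥2 1≤n even) even valid)
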